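{- Let $k$ be a field, $A$ a commutative $k$-algebra, $\Xi:A\to A$ a $k$-linear map, and $\Psi$ the associated invariant. Then $\Psi$ distinguishes rooted trees (i.e. for all rooted trees $T_1,T_2$, $\Psi(T_1)=\Psi(T_2)$ if and only if $T_1\cong T_2$) if and only if $\Psi$ is finer than $\alpha$, i.e. for all rooted trees $T_1,T_2$, $\alpha(T_1)\neq\alpha(T_2)$ implies $\Psi(T_1)\ne\Psi(T_2)$.
   Context: A rooted tree is a finite connected acyclic graph with a distinguished vertex (its root); isomorphisms are root-preserving. $\alpha(T)$ is the order of the group of root-preserving automorphisms of $T$. In a rooted tree, a vertex $w$ is a child of $v$ if $v,w$ are joined by an edge and $w$ is farther from the root than $v$; a leaf is a vertex without children. The invariant $\Psi$ is defined as follows. For a rooted tree $T$, assign to each vertex $v$ an element $N_v\in A$ inductively starting from the vertices farthest from the root: if $v$ is a leaf, $N_v=\Xi(1)$; otherwise $N_v=\Xi(N_{v_1}\cdots N_{v_k})$ where $v_1,\dots,v_k$ are the distinct children of $v$. Set $\Psi(T)=N_{\mathrm{rt}_T}$. -}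

module Defs where

open import Level using (Level; _⊔_) renaming (suc to lsuc; zero to lzero)
open import Algebra.Bundles using (CommutativeRing)
open import Algebra.Morphism.Structures using (module RingMorphisms)
open import Data.List using (List; []; _∷_; length; lookup)
open import Data.Fin using (Fin)
open import Data.Nat using (ℕ)
open import Data.Product using (Σ; ∃; _×_; _,_)
open import Data.Sum using (_⊎_)
open import Relation.Nullary using (¬_)
open import Relation.Binary using (Setoid; IsEquivalence)
open import Relation.Binary.PropositionalEquality as ≡ using (_≡_)
open import Function.Bundles using (_⤖_; _⇔_; Bijection; Equivalence)

record Field (c ℓ : Level) : Set (lsuc (c ⊔ ℓ)) where
  field
    commutativeRing : CommutativeRing c ℓ
  open CommutativeRing commutativeRing public
  field
    1≉0     : ¬ (1# ≈ 0#)
    inverse : ∀ x → ¬ (x ≈ 0#) → Σ Carrier (λ y → x * y ≈ 1#)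

record CommAlgebra {c ℓ} (k : Field c ℓ) (c′ ℓ′ : Level)
       : Set (c ⊔ ℓ ⊔ lsuc (c′ ⊔ ℓ′)) where
  private module k = Field k
  field
    commRing : CommutativeRing c′ ℓ′
  open CommutativeRing commRing public
  open RingMorphisms k.rawRing rawRing using (IsRingHomomorphism)
  field
    ι      : k.Carrier → Carrier
    ι-hom  : IsRingHomomorphism ι

  _·_ : k.Carrier → Carrier → Carrier
  a · x = ι a * x

record LinearMap {c ℓ c′ ℓ′} {k : Field c ℓ} (A : CommAlgebra k c′ ℓ′)
       : Set (c ⊔ c′ ⊔ ℓ′) where
  private module k = Field k
  open CommAlgebra A
  field
    fun    : Carrier → Carrier
    cong   : ∀ {x y} → x ≈ y → fun x ≈ fun y
    +-lin  : ∀ x y → fun (x + y) ≈ fun x + fun y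
    ·-lin  : ∀ (a : k.Carrier) x → fun (a · x) ≈ a · fun x

data Tree : Set where
  node : List Tree → Tree

data Vertex : Tree → Set where
  root  : ∀ {ts} → Vertex (node ts)
  below : ∀ {ts} (i : Fin (length ts)) → Vertex (lookup ts i) → Vertex (node ts)

rt : (T : Tree) → Vertex T
rt (node ts) = root

data ChildOf : {T : Tree} → Vertex T → Vertex T → Set where
  top  : ∀ {ts} (i : Fin (length ts)) → ChildOf {node ts} (below i (rt (lookup ts i))) root
  deep : ∀ {ts} (i : Fin (length ts)) {w v : Vertex (lookup ts i)} →
         ChildOf w v → ChildOf {node ts} (below i w) (below i v)

Edge : {T : Tree} → Vertex T → Vertex T → Set
Edge v w = ChildOf v w ⊎ ChildOf w v

record Iso (T₁ T₂ : Tree) : Set where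
  field
    bij       : Vertex T₁ ⤖ Vertex T₂
  open Bijection bij public using (to)
  field
    root-pres : to (rt T₁) ≡ rt T₂
    edge-pres : ∀ v w → Edge v w ⇔ Edge (to v) (to w)

_≅_ : Tree → Tree → Set
T₁ ≅ T₂ = Iso T₁ T₂

AutSetoid : Tree → Setoid lzero lzero
AutSetoid T = record
  { Carrier       = Iso T T
  ; _≈_           = λ f g → ∀ v → Iso.to f v ≡ Iso.to g v
  ; isEquivalence = record
      { refl  = λ v → ≡.refl
      ; sym   = λ p v → ≡.sym (p v)
      ; trans = λ p q v → ≡.trans (p v) (q v)
      }
  }

-- α(T) = m : the automorphism group of T has exactly m elements.
AutOrder : Tree → ℕ → Set
AutOrder T m = Bijection (AutSetoid T) (≡.setoid (Fin m))

module Invariant {c ℓ c′ ℓ′} {k : Field c ℓ} (A : CommAlgebra k c′ ℓ′)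
                 (Ξ : LinearMap A) where
  open CommAlgebra A
  open LinearMap Ξ renaming (fun to Ξf)

  mutual
    Ψ : Tree → Carrier
    Ψ (node [])       = Ξf 1#
    Ψ (node (t ∷ ts)) = Ξf (prodΨ (t ∷ ts))

    prodΨ : List Tree → Carrier
    prodΨ []       = 1#
    prodΨ (t ∷ ts) = Ψ t * prodΨ ts

  Distinguishes : Set ℓ′
  Distinguishes = ∀ T₁ T₂ → (Ψ T₁ ≈ Ψ T₂ → T₁ ≅ T₂) × (T₁ ≅ T₂ → Ψ T₁ ≈ Ψ T₂)

  FinerThanα : Set ℓ′
  FinerThanα = ∀ T₁ T₂ m₁ m₂ → AutOrder T₁ m₁ → AutOrder T₂ m₂ →
               ¬ (m₁ ≡ m₂) → ¬ (Ψ T₁ ≈ Ψ T₂)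

-- If Ψ is finer than α and Ψ(T₁) = Ψ(T₂), then T₁ and T₂ have automorphism groups of a
-- common order m. Were T₁ ≇ T₂, the trees whose root has children T₁, T₂ and T₁, T₁
-- would have the same Ψ, namely Ξ(Ψ(T₁) Ψ(T₂)) = Ξ(Ψ(T₁)²), while an automorphism of
-- either one either fixes or swaps the two branches, so their automorphism groups have
-- orders m·m + 0·0 and m·m + m·m. Isomorphism of finite trees is decidable (there are
-- finitely many vertex maps to test), so this contradiction yields T₁ ≅ T₂. Conversely, an isomorphism permutes the children of the
-- root, so Ψ is invariant by commutativity, and conjugation identifies the automorphism
-- groups of isomorphic trees.
module Submission where

open import Defs
open import Level using (Level)
open import Function.Bundles using (_⇔_)

import Algebra.Properties.CommutativeMonoid.Sum as MonoidSum
open import Data.Bool using (if_then_else_)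
open import Data.Empty using (⊥-elim)
open import Data.Fin as Fin using (Fin; zero; suc)
open import Data.Fin.Patterns using (0F; 1F)
open import Data.Fin.Permutation as Perm using (Permutation; permutation; _⟨$⟩ʳ_; _⟨$⟩ˡ_)
open import Data.Fin.Properties using (injective⇒≤; +↔⊎; *↔×)
open import Data.List using (List; []; _∷_; length; lookup; map; _++_; mapMaybe; deduplicate; cartesianProductWith)
open import Data.List.Membership.Propositional.Properties using (∈-lookup; ∈-map⁺; ∈-++⁺ˡ; ∈-++⁺ʳ)
open import Data.List.Relation.Unary.All as All using (all?)
open import Data.List.Relation.Unary.AllPairs using (_∷_)
open import Data.List.Relation.Unary.Any as Any using (Any; here; there; any?)
open import Data.List.Relation.Unary.Any.Properties using (cartesianProductWith⁺; mapMaybe⁺; map⁺)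
open import Data.List.Relation.Unary.Enumerates.Setoid using (IsEnumeration)
open import Data.List.Relation.Unary.Enumerates.Setoid.Properties using (deduplicate⁺; lookup-surjective)
open import Data.List.Relation.Unary.Unique.DecSetoid.Properties using (deduplicate-!)
open import Data.List.Relation.Unary.Unique.Setoid using (Unique)
open import Data.Maybe as Maybe using ()
import Data.Maybe.Relation.Unary.Any as MaybeAny
open import Data.Nat as ℕ using (ℕ; _≤_; _+_; _*_)
open import Data.Nat.Properties using (≤-antisym; +-cancelˡ-≡)
open import Data.Product using (Σ; ∃; ∃₂; _×_; _,_; proj₁; proj₂; uncurry)
open import Data.Product.Function.NonDependent.Setoid using (_×-bijection_)
open import Data.Product.Relation.Binary.Pointwise.NonDependent using (_×ₛ_)
  renaming (Pointwise-≡↔≡ to ×-Pointwise-≡↔≡)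
open import Data.Sum using (_⊎_; inj₁; inj₂; swap)
open import Data.Sum.Function.Setoid using (_⊎-bijection_)
open import Data.Sum.Relation.Binary.Pointwise using (_⊎ₛ_; inj₁; inj₂)
  renaming (Pointwise-≡↔≡ to ⊎-Pointwise-≡↔≡)
open import Function using (_∘_; id; const; case_of_)
open import Function.Bundles using (Bijection; Injection; Equivalence; mk⇔)
open import Function.Consequences.Propositional using (strictlySurjective⇒surjective)
import Function.Consequences.Setoid as SetoidConsequences
import Function.Construct.Composition as Composition
import Function.Construct.Symmetry as Symmetry
open import Function.Definitions using (Injective; StrictlySurjective)
import Function.Properties.Equivalence as ⇔
open import Function.Properties.Inverse using (Inverse⇒Bijection; ↔-sym)
open import Relation.Binary using (Setoid; DecSetoid; DecidableEquality)
open import Relation.Binary.PropositionalEquality as ≡ using (_≡_; _≢_; _≗_; refl)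
import Relation.Binary.Reasoning.Setoid as SetoidReasoning
open import Relation.Nullary using (Dec; yes; no; does; ¬_)
open import Relation.Nullary.Decidable using (map′; dec⇒maybe; decidable-stable; _×-dec_; _→-dec_; _⊎-dec_)
open import Relation.Unary using (Decidable)

private variable a b p ℓ : Level

-- Finite enumerations

module _ (S : DecSetoid a ℓ) where
  open DecSetoid S using (_≈_; _≟_; setoid; reflexive; sym; trans)

  unique-lookup-injective : ∀ {xs} → Unique setoid xs → ∀ {i j} → lookup xs i ≈ lookup xs j → i ≡ j
  unique-lookup-injective (_ ∷ _)  {zero}  {zero}  _  = refl
  unique-lookup-injective (x≉ ∷ _) {zero}  {suc j} x≈ = ⊥-elim (All.lookup x≉ (∈-lookup j) x≈)
  unique-lookup-injective (x≉ ∷ _) {suc i} {zero}  ≈x = ⊥-elim (All.lookup x≉ (∈-lookup i) (sym ≈x))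
  unique-lookup-injective (_ ∷ u)  {suc i} {suc j} eq = ≡.cong suc (unique-lookup-injective u eq)

  enumerated⇒finite : ∀ {xs} → IsEnumeration setoid xs → ∃ λ m → Bijection setoid (≡.setoid (Fin m))
  enumerated⇒finite {xs} complete = length ys , Symmetry.bijection lookupBijection from-cong
    where
    ys = deduplicate _≟_ xs
    lookup-injective = unique-lookup-injective (deduplicate-! S xs)
    lookupBijection : Bijection (≡.setoid (Fin (length ys))) setoid
    lookupBijection = record
      { to        = lookup ys
      ; cong      = reflexive ∘ ≡.cong (lookup ys)
      ; bijective = lookup-injective , lookup-surjective setoid (deduplicate⁺ S complete)
      }
    open Bijection lookupBijection using (surjective)
    from-cong : ∀ {x y} → x ≈ y → proj₁ (surjective x) ≡ proj₁ (surjective y)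
    from-cong x≈y = lookup-injective
      (trans (proj₂ (surjective _) refl) (trans x≈y (sym (proj₂ (surjective _) refl))))

module _ {A : Set a} {xs : List A} (complete : IsEnumeration (≡.setoid A) xs) where

  ∀? : {P : A → Set p} → Decidable P → Dec (∀ x → P x)
  ∀? P? = map′ (λ all x → All.lookup all (complete x)) (λ ∀P → All.tabulate (λ _ → ∀P _)) (all? P? xs)

  ∃? : {P : A → Set p} → Decidable P → Dec (∃ P)
  ∃? P? = map′ Any.satisfied (λ (x , px) → Any.map (λ { refl → px }) (complete x)) (any? P? xs)

module _ {A : Set a} {B : Set b} (_≟_ : DecidableEquality A) {ys : List B}
         (complete : IsEnumeration (≡.setoid B) ys) (b₀ : B) where

  update : A → B → (A → B) → A → B
  update x y f a = if does (a ≟ x) then y else f a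

  functionsOn : List A → List (A → B)
  functionsOn []       = const b₀ ∷ []
  functionsOn (x ∷ xs) = cartesianProductWith (update x) ys (functionsOn xs)

  functionsOn-complete : ∀ xs (f : A → B) →
                         Any (λ g → ∀ {a} → Any (a ≡_) xs → f a ≡ g a) (functionsOn xs)
  functionsOn-complete []       f = here λ ()
  functionsOn-complete (x ∷ xs) f =
    cartesianProductWith⁺ (update x) agree (complete (f x)) (functionsOn-complete xs f)
    where
    agree : ∀ {y g} → f x ≡ y → (∀ {a} → Any (a ≡_) xs → f a ≡ g a) →
            ∀ {a} → Any (a ≡_) (x ∷ xs) → f a ≡ update x y g a
    agree {y} {g} fx≡y f≗g {a} a∈ with a ≟ x | a∈
    ... | yes refl | _          = fx≡y
    ... | no a≢x   | here a≡x   = ⊥-elim (a≢x a≡x)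
    ... | no _     | there a∈xs = f≗g a∈xs

module _ {a₁ a₂ ℓ₁ ℓ₂} {S : Setoid a₁ ℓ₁} {T : Setoid a₂ ℓ₂} {m n : ℕ} where

  injection⇒card-≤ : Injection S T → Bijection S (≡.setoid (Fin m)) → Bijection T (≡.setoid (Fin n)) → m ≤ n
  injection⇒card-≤ ι β γ = injective⇒≤ injective
    where
    from = proj₁ ∘ Bijection.surjective β
    from-section : ∀ x → Bijection.to β (from x) ≡ x
    from-section x = proj₂ (Bijection.surjective β x) (Setoid.refl S)
    injective : Injective _≡_ _≡_ (Bijection.to γ ∘ Injection.to ι ∘ from)
    injective {x} {y} eq = ≡.trans (≡.sym (from-section x))
      (≡.trans (Bijection.cong β (Injection.injective ι (Bijection.injective γ eq))) (from-section y))

  card-× : Bijection S (≡.setoid (Fin m)) → Bijection T (≡.setoid (Fin n)) →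
           Bijection (S ×ₛ T) (≡.setoid (Fin (m * n)))
  card-× β γ = Composition.bijection (β ×-bijection γ)
    (Composition.bijection (Inverse⇒Bijection ×-Pointwise-≡↔≡) (Inverse⇒Bijection (↔-sym *↔×)))

  card-⊎ : Bijection S (≡.setoid (Fin m)) → Bijection T (≡.setoid (Fin n)) →
           Bijection (S ⊎ₛ T) (≡.setoid (Fin (m + n)))
  card-⊎ β γ = Composition.bijection (β ⊎-bijection γ)
    (Composition.bijection (Inverse⇒Bijection (⊎-Pointwise-≡↔≡ _ _)) (Inverse⇒Bijection (↔-sym +↔⊎)))

-- Vertices and edges

below-injective : ∀ {ts i} {v w : Vertex (lookup ts i)} → below {ts} i v ≡ below i w → v ≡ w
below-injective refl = refl

below-index : ∀ {ts i j} {v w} → below {ts} i v ≡ below j w → i ≡ j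
below-index refl = refl

_≟ᵛ_ : ∀ {T} → DecidableEquality (Vertex T)
root      ≟ᵛ root      = yes refl
root      ≟ᵛ below _ _ = no λ ()
below _ _ ≟ᵛ root      = no λ ()
below i v ≟ᵛ below j w with i Fin.≟ j
... | no i≢j   = no (i≢j ∘ below-index)
... | yes refl = map′ (≡.cong (below i)) below-injective (v ≟ᵛ w)

mutual
  vertices : (T : Tree) → List (Vertex T)
  vertices (node ts) = root ∷ map (uncurry below) (branchVertices ts)

  branchVertices : (ts : List Tree) → List (Σ (Fin (length ts)) (Vertex ∘ lookup ts))
  branchVertices []       = []
  branchVertices (t ∷ ts) = map (zero ,_) (vertices t) ++ map (λ (i , v) → suc i , v) (branchVertices ts)

mutual
  vertices-complete : ∀ T → IsEnumeration (≡.setoid (Vertex T)) (vertices T)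
  vertices-complete (node ts) root        = here refl
  vertices-complete (node ts) (below i v) = there (∈-map⁺ (uncurry below) (branchVertices-complete ts i v))

  branchVertices-complete : ∀ ts i (v : Vertex (lookup ts i)) → Any ((i , v) ≡_) (branchVertices ts)
  branchVertices-complete (t ∷ ts) zero    v = ∈-++⁺ˡ (∈-map⁺ (zero ,_) (vertices-complete t v))
  branchVertices-complete (t ∷ ts) (suc i) v =
    ∈-++⁺ʳ _ (∈-map⁺ (λ (i , v) → suc i , v) (branchVertices-complete ts i v))

child? : ∀ {T} (w v : Vertex T) → Dec (ChildOf w v)
child? root        v           = no λ ()
child? (below i w) root        with w ≟ᵛ rt _
... | yes refl = yes (top i)
... | no w≢rt  = no λ { (top _) → w≢rt refl }
child? (below i w) (below j v) with i Fin.≟ j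
... | no i≢j   = no λ { (deep _ _) → i≢j refl }
... | yes refl = map′ (deep i) (λ { (deep _ c) → c }) (child? w v)

edge? : ∀ {T} (v w : Vertex T) → Dec (Edge v w)
edge? v w = child? v w ⊎-dec child? w v

edge-sym : ∀ {T} {v w : Vertex T} → Edge v w ⇔ Edge w v
edge-sym = mk⇔ swap swap

edge-below : ∀ {ts} i {v w : Vertex (lookup ts i)} → Edge v w ⇔ Edge (below {ts} i v) (below i w)
edge-below i = mk⇔ (λ { (inj₁ c) → inj₁ (deep i c) ; (inj₂ c) → inj₂ (deep i c) })
                   (λ { (inj₁ (deep _ c)) → inj₁ c ; (inj₂ (deep _ c)) → inj₂ c })

edge-root-below : ∀ {ts i} {v : Vertex (lookup ts i)} → Edge root (below {ts} i v) ⇔ v ≡ rt (lookup ts i)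
edge-root-below {i = i} = mk⇔ (λ { (inj₂ (top _)) → refl }) (λ { refl → inj₂ (top i) })

edge-same-branch : ∀ {ts i j v w} → Edge (below {ts} i v) (below j w) → i ≡ j
edge-same-branch (inj₁ (deep _ _)) = refl
edge-same-branch (inj₂ (deep _ _)) = refl

data RootPath : {T : Tree} → Vertex T → Set where
  start : ∀ {T} → RootPath (rt T)
  step  : ∀ {T} {w v : Vertex T} → ChildOf w v → RootPath v → RootPath w

rootPath-below : ∀ {ts} i {v} → RootPath {lookup ts i} v → RootPath {node ts} (below i v)
rootPath-below i start      = step (top i) start
rootPath-below i (step c r) = step (deep i c) (rootPath-below i r)

rootPath : ∀ {T} (v : Vertex T) → RootPath v
rootPath root        = start
rootPath (below i v) = rootPath-below i (rootPath v)

-- Isomorphisms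

record IsIsoMap {T₁ T₂ : Tree} (h : Vertex T₁ → Vertex T₂) : Set where
  field
    injective  : Injective _≡_ _≡_ h
    surjective : StrictlySurjective _≡_ h
    root-pres  : h (rt T₁) ≡ rt T₂
    edge-pres  : ∀ v w → Edge v w ⇔ Edge (h v) (h w)

module _ {T₁ T₂ : Tree} where

  toIso : {h : Vertex T₁ → Vertex T₂} → IsIsoMap h → T₁ ≅ T₂
  toIso {h} m = record
    { bij       = record { to = h ; cong = ≡.cong h
                         ; bijective = injective , strictlySurjective⇒surjective surjective }
    ; root-pres = root-pres
    ; edge-pres = edge-pres
    }
    where open IsIsoMap m

  isIsoMap : (f : T₁ ≅ T₂) → IsIsoMap (Iso.to f)
  isIsoMap f = record
    { injective  = Bijection.injective bij
    ; surjective = Bijection.strictlySurjective bij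
    ; root-pres  = root-pres
    ; edge-pres  = edge-pres
    }
    where open Iso f

  isIsoMap-resp : {h h′ : Vertex T₁ → Vertex T₂} → h ≗ h′ → IsIsoMap h → IsIsoMap h′
  isIsoMap-resp {h} {h′} h≗h′ m = record
    { injective  = λ eq → injective (≡.trans (h≗h′ _) (≡.trans eq (≡.sym (h≗h′ _))))
    ; surjective = λ y → let (x , hx≡y) = surjective y in x , ≡.trans (≡.sym (h≗h′ x)) hx≡y
    ; root-pres  = ≡.trans (≡.sym (h≗h′ _)) root-pres
    ; edge-pres  = λ v w → ≡.subst₂ (λ x y → Edge v w ⇔ Edge x y) (h≗h′ v) (h≗h′ w) (edge-pres v w)
    }
    where open IsIsoMap m

  isIsoMap? : (h : Vertex T₁ → Vertex T₂) → Dec (IsIsoMap h)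
  isIsoMap? h = map′ fromParts toParts
    (∀?₁ (λ x → ∀?₁ (λ y → (h x ≟ᵛ h y) →-dec (x ≟ᵛ y)))
    ×-dec ∀?₂ (λ y → ∃?₁ (λ x → h x ≟ᵛ y))
    ×-dec (h (rt T₁) ≟ᵛ rt T₂)
    ×-dec ∀?₁ (λ v → ∀?₁ (λ w → (edge? v w →-dec edge? (h v) (h w))
                             ×-dec (edge? (h v) (h w) →-dec edge? v w))))
    where
    ∀?₁ = ∀? (vertices-complete T₁)
    ∃?₁ = ∃? (vertices-complete T₁)
    ∀?₂ = ∀? (vertices-complete T₂)
    Parts : Set
    Parts = (∀ x y → h x ≡ h y → x ≡ y) × StrictlySurjective _≡_ h × h (rt T₁) ≡ rt T₂ ×
            (∀ v w → (Edge v w → Edge (h v) (h w)) × (Edge (h v) (h w) → Edge v w))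
    fromParts : Parts → IsIsoMap h
    fromParts (inj , surj , rt≡ , edges) = record
      { injective = λ {x} {y} → inj x y ; surjective = surj ; root-pres = rt≡
      ; edge-pres = λ v w → uncurry mk⇔ (edges v w) }
    toParts : IsIsoMap h → Parts
    toParts m = (λ x y → injective) , surjective , root-pres ,
                λ v w → Equivalence.to (edge-pres v w) , Equivalence.from (edge-pres v w)
      where open IsIsoMap m

_≈ᵢ_ : ∀ {T₁ T₂} → T₁ ≅ T₂ → T₁ ≅ T₂ → Set
f ≈ᵢ g = ∀ v → Iso.to f v ≡ Iso.to g v

IsoSetoid : Tree → Tree → Setoid _ _
IsoSetoid T₁ T₂ = record
  { Carrier       = Iso T₁ T₂
  ; _≈_           = _≈ᵢ_
  ; isEquivalence = record
      { refl  = λ v → ≡.refl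
      ; sym   = λ p v → ≡.sym (p v)
      ; trans = λ p q v → ≡.trans (p v) (q v)
      }
  }

IsoOrder : Tree → Tree → ℕ → Set
IsoOrder T₁ T₂ m = Bijection (IsoSetoid T₁ T₂) (≡.setoid (Fin m))

module _ (T₁ T₂ : Tree) where

  IsoDecSetoid : DecSetoid _ _
  IsoDecSetoid = record
    { isDecEquivalence = record
        { isEquivalence = Setoid.isEquivalence (IsoSetoid T₁ T₂)
        ; _≟_           = λ f g → ∀? (vertices-complete T₁) (λ v → Iso.to f v ≟ᵛ Iso.to g v)
        }
    }

  isos : List (T₁ ≅ T₂)
  isos = mapMaybe (λ h → Maybe.map toIso (dec⇒maybe (isIsoMap? h)))
                  (functionsOn _≟ᵛ_ (vertices-complete T₂) (rt T₂) (vertices T₁))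

  isos-complete : IsEnumeration (IsoSetoid T₁ T₂) isos
  isos-complete f = mapMaybe⁺ _ _ (map⁺ (Any.map agreeing
    (functionsOn-complete _≟ᵛ_ (vertices-complete T₂) (rt T₂) (vertices T₁) (Iso.to f))))
    where
    agreeing : ∀ {h} → (∀ {v} → Any (v ≡_) (vertices T₁) → Iso.to f v ≡ h v) →
               MaybeAny.Any (f ≈ᵢ_) (Maybe.map toIso (dec⇒maybe (isIsoMap? h)))
    agreeing {h} f≗h with isIsoMap? h
    ... | yes _ = MaybeAny.just λ v → f≗h (vertices-complete T₁ v)
    ... | no ¬m = ⊥-elim (¬m (isIsoMap-resp (λ v → f≗h (vertices-complete T₁ v)) (isIsoMap f)))

  isoOrder : ∃ (IsoOrder T₁ T₂)
  isoOrder = enumerated⇒finite IsoDecSetoid isos-complete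

  iso? : Dec (T₁ ≅ T₂)
  iso? with isos | isos-complete
  ... | []    | complete = no λ f → case complete f of λ ()
  ... | f ∷ _ | _        = yes f

isoOrder-empty : ∀ {T₁ T₂} → ¬ T₁ ≅ T₂ → IsoOrder T₁ T₂ 0
isoOrder-empty ¬iso = record
  { to        = ⊥-elim ∘ ¬iso
  ; cong      = λ {f} → ⊥-elim (¬iso f)
  ; bijective = (λ {f} → ⊥-elim (¬iso f)) , λ ()
  }

≅-refl : ∀ {T} → T ≅ T
≅-refl = toIso record
  { injective = id ; surjective = λ y → y , refl ; root-pres = refl ; edge-pres = λ _ _ → ⇔.refl }

≅-trans : ∀ {T₁ T₂ T₃} → T₁ ≅ T₂ → T₂ ≅ T₃ → T₁ ≅ T₃
≅-trans f g = toIso record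
  { injective  = F.injective ∘ G.injective
  ; surjective = λ z → let (y , gy≡z) = G.surjective z ; (x , fx≡y) = F.surjective y
                       in x , ≡.trans (≡.cong (Iso.to g) fx≡y) gy≡z
  ; root-pres  = ≡.trans (≡.cong (Iso.to g) F.root-pres) G.root-pres
  ; edge-pres  = λ v w → ⇔.trans (F.edge-pres v w) (G.edge-pres _ _)
  }
  where module F = IsIsoMap (isIsoMap f); module G = IsIsoMap (isIsoMap g)

module _ {T₁ T₂} (f : T₁ ≅ T₂) where
  private module F = IsIsoMap (isIsoMap f)

  inverse : Vertex T₂ → Vertex T₁
  inverse = proj₁ ∘ F.surjective

  inverseʳ : ∀ y → Iso.to f (inverse y) ≡ y
  inverseʳ = proj₂ ∘ F.surjective

  inverseˡ : ∀ x → inverse (Iso.to f x) ≡ x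
  inverseˡ x = F.injective (inverseʳ (Iso.to f x))

  ≅-sym : T₂ ≅ T₁
  ≅-sym = toIso record
    { injective  = λ {x} {y} eq → ≡.trans (≡.sym (inverseʳ x)) (≡.trans (≡.cong (Iso.to f) eq) (inverseʳ y))
    ; surjective = λ x → Iso.to f x , inverseˡ x
    ; root-pres  = F.injective (≡.trans (inverseʳ _) (≡.sym F.root-pres))
    ; edge-pres  = λ v w → ≡.subst₂ (λ x y → Edge x y ⇔ Edge (inverse v) (inverse w))
                            (inverseʳ v) (inverseʳ w) (⇔.sym (F.edge-pres _ _))
    }

  ≅-root : ∀ {v} → v ≡ rt T₁ ⇔ Iso.to f v ≡ rt T₂
  ≅-root = mk⇔ (λ { refl → F.root-pres }) (λ fv≡rt → F.injective (≡.trans fv≡rt (≡.sym F.root-pres)))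

conjugation : ∀ {T₁ T₂} → T₁ ≅ T₂ → Injection (AutSetoid T₁) (AutSetoid T₂)
conjugation f = record
  { to        = λ a → ≅-trans (≅-sym f) (≅-trans a f)
  ; cong      = λ a≈b v → ≡.cong (Iso.to f) (a≈b (inverse f v))
  ; injective = λ {a} {b} ca≈cb v → IsIsoMap.injective (isIsoMap f)
      (≡.subst (λ u → Iso.to f (Iso.to a u) ≡ Iso.to f (Iso.to b u)) (inverseˡ f v) (ca≈cb (Iso.to f v)))
  }

autOrder-≅ : ∀ {T₁ T₂ m₁ m₂} → T₁ ≅ T₂ → AutOrder T₁ m₁ → AutOrder T₂ m₂ → m₁ ≡ m₂
autOrder-≅ f α₁ α₂ =
  ≤-antisym (injection⇒card-≤ (conjugation f) α₁ α₂) (injection⇒card-≤ (conjugation (≅-sym f)) α₂ α₁)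

-- Branches of an isomorphism

branchRoot : ∀ {ts} (i : Fin (length ts)) → Vertex (node ts)
branchRoot {ts} i = below i (rt (lookup ts i))

neighbour-of-root : ∀ {ts} {x : Vertex (node ts)} → Edge x root → ∃ λ j → x ≡ branchRoot j
neighbour-of-root (inj₁ (top j)) = j , refl

neighbour-in-branch : ∀ {ts j y} {x : Vertex (node ts)} → Edge x (below j y) → x ≡ root ⊎ ∃ λ z → x ≡ below j z
neighbour-in-branch (inj₁ (deep _ _)) = inj₂ (_ , refl)
neighbour-in-branch (inj₂ (top _))    = inj₁ refl
neighbour-in-branch (inj₂ (deep _ _)) = inj₂ (_ , refl)

module Branches {ts us : List Tree} (f : node ts ≅ node us) where
  open IsIsoMap (isIsoMap f)
  private
    F = Iso.to f

  reflects-root : ∀ {x} → F x ≡ root → x ≡ root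
  reflects-root Fx≡root = injective (≡.trans Fx≡root (≡.sym root-pres))

  branchImage : ∀ i → ∃ λ j → F (branchRoot i) ≡ branchRoot j
  branchImage i = neighbour-of-root
    (≡.subst (Edge _) root-pres (Equivalence.to (edge-pres (branchRoot i) root) (inj₁ (top i))))

  branchMap : Fin (length ts) → Fin (length us)
  branchMap i = proj₁ (branchImage i)

  branchMap-root : ∀ i → F (branchRoot i) ≡ branchRoot (branchMap i)
  branchMap-root i = proj₂ (branchImage i)

  module _ {i j} (i↦j : F (branchRoot i) ≡ branchRoot j) where

    -- A neighbour of a vertex of branch j is the root or lies in branch j, and only the root maps to the root.
    maps-branch : ∀ {v} → RootPath {lookup ts i} v → ∃ λ w → F (below i v) ≡ below j w
    maps-branch start = _ , i↦j
    maps-branch (step {w = w} c path) with maps-branch path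
    ... | y , Fv≡y with neighbour-in-branch (≡.subst (Edge (F (below i w))) Fv≡y
                          (Equivalence.to (edge-pres _ _) (inj₁ (deep i c))))
    ... | inj₁ Fw≡root = case reflects-root Fw≡root of λ ()
    ... | inj₂ image   = image

    restrictMap : Vertex (lookup ts i) → Vertex (lookup us j)
    restrictMap v = proj₁ (maps-branch (rootPath v))

    restrict-below : ∀ v → F (below i v) ≡ below j (restrictMap v)
    restrict-below v = proj₂ (maps-branch (rootPath v))

  branch-determined : ∀ {i j i′ v y} → F (branchRoot i) ≡ branchRoot j → F (below i′ v) ≡ below j y → i′ ≡ i
  branch-determined {i′ = i′} {v} i↦j Fv≡y =
    let (j′ , i′↦j′) = branchImage i′
        j′≡j = below-index (≡.trans (≡.sym (restrict-below i′↦j′ v)) Fv≡y)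
    in below-index (injective (≡.trans i′↦j′ (≡.trans (≡.cong branchRoot j′≡j) (≡.sym i↦j))))

  restrict : ∀ {i j} → F (branchRoot i) ≡ branchRoot j → lookup ts i ≅ lookup us j
  restrict {i} {j} i↦j = toIso record
    { injective  = λ {v} {w} gv≡gw → below-injective (injective
        (≡.trans (restrict-below i↦j v) (≡.trans (≡.cong (below j) gv≡gw) (≡.sym (restrict-below i↦j w)))))
    ; surjective = λ y → preimage y (surjective (below j y))
    ; root-pres  = below-injective (≡.trans (≡.sym (restrict-below i↦j _)) i↦j)
    ; edge-pres  = λ v w → ⇔.trans
        (≡.subst₂ (λ x y → Edge v w ⇔ Edge x y) (restrict-below i↦j v) (restrict-below i↦j w)
                  (⇔.trans (edge-below i) (edge-pres _ _)))
        (⇔.sym (edge-below j))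
    }
    where
    preimage : ∀ y → (∃ λ x → F x ≡ below j y) → ∃ λ v → restrictMap i↦j v ≡ y
    preimage y (root , Fx≡y) = case ≡.trans (≡.sym root-pres) Fx≡y of λ ()
    preimage y (below i′ v , Fx≡y) with branch-determined i↦j Fx≡y
    ... | refl = v , below-injective (≡.trans (≡.sym (restrict-below i↦j v)) Fx≡y)

  restrictBranch : ∀ i → lookup ts i ≅ lookup us (branchMap i)
  restrictBranch i = restrict (branchMap-root i)

branchPermutation : ∀ {ts us} → node ts ≅ node us → Permutation (length ts) (length us)
branchPermutation f = permutation σ τ
  (λ j → below-index (≡.trans (≡.sym (σ.branchMap-root (τ j)))
                      (≡.trans (≡.cong (Iso.to f) (≡.sym (τ.branchMap-root j))) (inverseʳ f _))))
  (λ i → below-index (≡.trans (≡.sym (τ.branchMap-root (σ i)))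
                      (≡.trans (≡.cong (inverse f) (≡.sym (σ.branchMap-root i))) (inverseˡ f _))))
  where
  module σ = Branches f
  module τ = Branches (≅-sym f)
  σ = σ.branchMap
  τ = τ.branchMap

module _ {ts us : List Tree} where
  open Branches using (restrict; restrict-below)

  restrict-cong : ∀ {f g : node ts ≅ node us} {i j} → f ≈ᵢ g → ∀ p q → restrict f {i} {j} p ≈ᵢ restrict g q
  restrict-cong {f} {g} f≈g p q v = below-injective
    (≡.trans (≡.sym (restrict-below f p v)) (≡.trans (f≈g _) (restrict-below g q v)))

  ≈ᵢ-from-branches : ∀ {f g : node ts ≅ node us} →
    (∀ i → ∃₂ λ j p → ∃ λ q → restrict f {i} {j} p ≈ᵢ restrict g q) → f ≈ᵢ g
  ≈ᵢ-from-branches {f} {g} agree root = ≡.trans (Iso.root-pres f) (≡.sym (Iso.root-pres g))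
  ≈ᵢ-from-branches {f} {g} agree (below i v) =
    let (j , p , q , fᵢ≈gᵢ) = agree i
    in ≡.trans (restrict-below f p v) (≡.trans (≡.cong (below j) (fᵢ≈gᵢ v)) (≡.sym (restrict-below g q v)))

-- Invariance of Ψ

module _ {c ℓ c′ ℓ′} {k : Field c ℓ} (A : CommAlgebra k c′ ℓ′) (Ξ : LinearMap A) where
  open CommAlgebra A using (_≈_; *-cong; setoid; *-commutativeMonoid)
  open Invariant A Ξ
  open LinearMap Ξ using () renaming (fun to Ξ′; cong to Ξ-cong)
  module Π = MonoidSum *-commutativeMonoid
  open SetoidReasoning setoid

  Ψ-node : ∀ ts → Ψ (node ts) ≡ Ξ′ (prodΨ ts)
  Ψ-node []      = ≡.refl
  Ψ-node (_ ∷ _) = ≡.refl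

  prodΨ-lookup : ∀ ts → prodΨ ts ≈ Π.sum (Ψ ∘ lookup ts)
  prodΨ-lookup []       = Setoid.refl setoid
  prodΨ-lookup (t ∷ ts) = *-cong (Setoid.refl setoid) (prodΨ-lookup ts)

  mutual
    Ψ-≅ : ∀ {T₁ T₂} → T₁ ≅ T₂ → Ψ T₁ ≈ Ψ T₂
    Ψ-≅ {node ts} {node us} f = begin
      Ψ (node ts)    ≡⟨ Ψ-node ts ⟩
      Ξ′ (prodΨ ts)  ≈⟨ Ξ-cong (prodΨ-≅ f) ⟩
      Ξ′ (prodΨ us)  ≡⟨ Ψ-node us ⟨
      Ψ (node us)    ∎

    prodΨ-≅ : ∀ {ts us} → node ts ≅ node us → prodΨ ts ≈ prodΨ us
    prodΨ-≅ {ts} {us} f = begin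
      prodΨ ts                           ≈⟨ prodΨ-lookup ts ⟩
      Π.sum (Ψ ∘ lookup ts)              ≈⟨ Π.sum-cong-≋ (λ i → Ψ-lookup-≅ ts i (restrictBranch i)) ⟩
      Π.sum (Ψ ∘ lookup us ∘ (π ⟨$⟩ʳ_))  ≈⟨ Π.sum-permute (Ψ ∘ lookup us) π ⟨
      Π.sum (Ψ ∘ lookup us)              ≈⟨ prodΨ-lookup us ⟨
      prodΨ us                           ∎
      where
      open Branches f
      π = branchPermutation f

    Ψ-lookup-≅ : ∀ ts i {u} → lookup ts i ≅ u → Ψ (lookup ts i) ≈ Ψ u
    Ψ-lookup-≅ (t ∷ ts) zero    f = Ψ-≅ {t} f
    Ψ-lookup-≅ (t ∷ ts) (suc i) f = Ψ-lookup-≅ ts i f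

-- Gluing isomorphisms of branches

module _ {ts us : List Tree} (π : Permutation (length ts) (length us))
         (h : ∀ i → lookup ts i ≅ lookup us (π ⟨$⟩ʳ i)) where

  extendMap : Vertex (node ts) → Vertex (node us)
  extendMap root        = root
  extendMap (below i v) = below (π ⟨$⟩ʳ i) (Iso.to (h i) v)

  private
    π-injective : ∀ {i j} → π ⟨$⟩ʳ i ≡ π ⟨$⟩ʳ j → i ≡ j
    π-injective eq = ≡.trans (≡.sym (Perm.inverseˡ π)) (≡.trans (≡.cong (π ⟨$⟩ˡ_) eq) (Perm.inverseˡ π))

    injective : Injective _≡_ _≡_ extendMap
    injective {root}      {root}        _  = refl
    injective {root}      {below _ _}   ()
    injective {below _ _} {root}        ()
    injective {below i v} {below i′ v′} eq with π-injective (below-index eq)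
    ... | refl = ≡.cong (below i) (IsIsoMap.injective (isIsoMap (h i)) (below-injective eq))

    surjective : StrictlySurjective _≡_ extendMap
    surjective root        = root , refl
    surjective (below j y) = hit (π ⟨$⟩ˡ j) (Perm.inverseʳ π) y
      where
      hit : ∀ i {j} → π ⟨$⟩ʳ i ≡ j → ∀ y → ∃ λ x → extendMap x ≡ below j y
      hit i refl y = let (v , hv≡y) = IsIsoMap.surjective (isIsoMap (h i)) y in below i v , ≡.cong (below _) hv≡y

    edge-pres : ∀ v w → Edge v w ⇔ Edge (extendMap v) (extendMap w)
    edge-pres root        root        = mk⇔ (λ { (inj₁ ()) ; (inj₂ ()) }) (λ { (inj₁ ()) ; (inj₂ ()) })
    edge-pres root        (below i v) = ⇔.trans edge-root-below (⇔.trans (≅-root (h i)) (⇔.sym edge-root-below))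
    edge-pres (below i v) root        = ⇔.trans edge-sym (⇔.trans (edge-pres root (below i v)) edge-sym)
    edge-pres (below i v) (below j w) with i Fin.≟ j
    ... | yes refl =
      ⇔.trans (⇔.sym (edge-below i)) (⇔.trans (IsIsoMap.edge-pres (isIsoMap (h i)) v w) (edge-below _))
    ... | no i≢j   = mk⇔ (⊥-elim ∘ i≢j ∘ edge-same-branch) (⊥-elim ∘ i≢j ∘ π-injective ∘ edge-same-branch)

  extend : node ts ≅ node us
  extend = toIso record { injective = injective ; surjective = surjective ; root-pres = refl ; edge-pres = edge-pres }

  restrict-extend : ∀ i p → Branches.restrict extend {i} p ≈ᵢ h i
  restrict-extend i p v = ≡.sym (below-injective (Branches.restrict-below extend p v))

-- Trees with two branches

node₂ : Tree → Tree → Tree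
node₂ A B = node (A ∷ B ∷ [])

swap₂ : Permutation 2 2
swap₂ = permutation flip flip flip-involutive flip-involutive
  where
  flip : Fin 2 → Fin 2
  flip 0F = 1F
  flip 1F = 0F
  flip-involutive : ∀ i → flip (flip i) ≡ i
  flip-involutive 0F = refl
  flip-involutive 1F = refl

module _ {A B C D : Tree} where
  open Branches using (branchImage; restrict)

  data Shape (f : node₂ A B ≅ node₂ C D) : Set where
    straight : Iso.to f (branchRoot 0F) ≡ branchRoot 0F → Iso.to f (branchRoot 1F) ≡ branchRoot 1F → Shape f
    crossed  : Iso.to f (branchRoot 0F) ≡ branchRoot 1F → Iso.to f (branchRoot 1F) ≡ branchRoot 0F → Shape f

  shape : ∀ f → Shape f
  shape f with branchImage f 0F | branchImage f 1F
  ... | 0F , p | 1F , q = straight p q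
  ... | 1F , p | 0F , q = crossed p q
  ... | 0F , p | 0F , q = case below-index (IsIsoMap.injective (isIsoMap f) (≡.trans p (≡.sym q))) of λ ()
  ... | 1F , p | 1F , q = case below-index (IsIsoMap.injective (isIsoMap f) (≡.trans p (≡.sym q))) of λ ()

  Decomposition : Setoid _ _
  Decomposition = (IsoSetoid A C ×ₛ IsoSetoid B D) ⊎ₛ (IsoSetoid A D ×ₛ IsoSetoid B C)
  open Setoid Decomposition using () renaming (Carrier to Parts; _≈_ to _≈ₚ_)

  decompose : ∀ f → Shape f → Parts
  decompose f (straight p q) = inj₁ (restrict f p , restrict f q)
  decompose f (crossed p q)  = inj₂ (restrict f p , restrict f q)

  assemble : Parts → node₂ A B ≅ node₂ C D
  assemble (inj₁ (α , β)) = extend Perm.id straightBranches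
    where
    straightBranches : ∀ i → lookup (A ∷ B ∷ []) i ≅ lookup (C ∷ D ∷ []) (Perm.id ⟨$⟩ʳ i)
    straightBranches 0F = α
    straightBranches 1F = β
  assemble (inj₂ (α , β)) = extend swap₂ crossedBranches
    where
    crossedBranches : ∀ i → lookup (A ∷ B ∷ []) i ≅ lookup (C ∷ D ∷ []) (swap₂ ⟨$⟩ʳ i)
    crossedBranches 0F = α
    crossedBranches 1F = β

  first-branch-image : ∀ {f g : node₂ A B ≅ node₂ C D} {i j : Fin 2} → f ≈ᵢ g →
    Iso.to f (branchRoot 0F) ≡ branchRoot i → Iso.to g (branchRoot 0F) ≡ branchRoot j → i ≡ j
  first-branch-image f≈g p q = below-index (≡.trans (≡.sym p) (≡.trans (f≈g _) q))

  decompose-cong : ∀ {f g} → f ≈ᵢ g → (s : Shape f) (t : Shape g) → decompose f s ≈ₚ decompose g t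
  decompose-cong f≈g (straight p q) (straight p′ q′) = inj₁ (restrict-cong f≈g p p′ , restrict-cong f≈g q q′)
  decompose-cong f≈g (crossed p q)  (crossed p′ q′)  = inj₂ (restrict-cong f≈g p p′ , restrict-cong f≈g q q′)
  decompose-cong {f} {g} f≈g (straight p _) (crossed p′ _)  = case first-branch-image {f} {g} f≈g p p′ of λ ()
  decompose-cong {f} {g} f≈g (crossed p _)  (straight p′ _) = case first-branch-image {f} {g} f≈g p p′ of λ ()

  decompose-injective : ∀ {f g} (s : Shape f) (t : Shape g) → decompose f s ≈ₚ decompose g t → f ≈ᵢ g
  decompose-injective (straight p q) (straight p′ q′) (inj₁ (e₀ , e₁)) =
    ≈ᵢ-from-branches λ { 0F → _ , p , p′ , e₀ ; 1F → _ , q , q′ , e₁ }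
  decompose-injective (crossed p q)  (crossed p′ q′)  (inj₂ (e₀ , e₁)) =
    ≈ᵢ-from-branches λ { 0F → _ , p , p′ , e₀ ; 1F → _ , q , q′ , e₁ }

  decompose-assemble : ∀ x (s : Shape (assemble x)) → decompose (assemble x) s ≈ₚ x
  decompose-assemble (inj₁ (α , β)) (straight p q) = inj₁ (restrict-extend _ _ 0F p , restrict-extend _ _ 1F q)
  decompose-assemble (inj₂ (α , β)) (crossed p q)  = inj₂ (restrict-extend _ _ 0F p , restrict-extend _ _ 1F q)
  decompose-assemble (inj₁ _)       (crossed p _)  = case below-index p of λ ()
  decompose-assemble (inj₂ _)       (straight p _) = case below-index p of λ ()

  node₂-decomposition : Bijection (IsoSetoid (node₂ A B) (node₂ C D)) Decomposition
  node₂-decomposition = record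
    { to        = λ f → decompose f (shape f)
    ; cong      = cong
    ; bijective = (λ {f} {g} → decompose-injective (shape f) (shape g))
                , SetoidConsequences.strictlySurjective⇒surjective (IsoSetoid _ _) Decomposition cong
                    (λ x → assemble x , decompose-assemble x (shape (assemble x)))
    }
    where
    cong : ∀ {f g} → f ≈ᵢ g → decompose f (shape f) ≈ₚ decompose g (shape g)
    cong {f} {g} f≈g = decompose-cong f≈g (shape f) (shape g)

isoOrder-node₂ : ∀ {A B C D a b c d} → IsoOrder A C a → IsoOrder B D b → IsoOrder A D c → IsoOrder B C d →
                 IsoOrder (node₂ A B) (node₂ C D) (a * b + c * d)
isoOrder-node₂ α β γ δ = Composition.bijection node₂-decomposition (card-⊎ (card-× α β) (card-× γ δ))

square≢double-square : ∀ {m} → Fin m → m * m + 0 * 0 ≢ m * m + m * m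
square≢double-square {ℕ.suc n} _ eq with +-cancelˡ-≡ (ℕ.suc n * ℕ.suc n) 0 (ℕ.suc n * ℕ.suc n) eq
... | ()

module _ {c ℓ c′ ℓ′} {k : Field c ℓ} (A : CommAlgebra k c′ ℓ′) (Ξ : LinearMap A) where
  open CommAlgebra A using (_≈_; *-cong) renaming (refl to ≈-refl; sym to ≈-sym)
  open Invariant A Ξ

  finer⇒Ψ-reflects-≅ : FinerThanα → ∀ {T₁ T₂} → Ψ T₁ ≈ Ψ T₂ → ¬ ¬ T₁ ≅ T₂
  finer⇒Ψ-reflects-≅ finer {T₁} {T₂} Ψ≈ T₁≇T₂ with isoOrder T₁ T₁ | isoOrder T₂ T₂
  ... | m₁ , α₁ | m₂ , α₂ with m₁ ℕ.≟ m₂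
  ... | no m₁≢m₂ = finer T₁ T₂ m₁ m₂ α₁ α₂ m₁≢m₂ Ψ≈
  ... | yes refl = finer (node₂ T₁ T₂) (node₂ T₁ T₁) _ _
        (isoOrder-node₂ α₁ α₂ (isoOrder-empty T₁≇T₂) (isoOrder-empty (T₁≇T₂ ∘ ≅-sym)))
        (isoOrder-node₂ α₁ α₁ α₁ α₁)
        (square≢double-square (Bijection.to α₁ ≅-refl))
        (LinearMap.cong Ξ (*-cong ≈-refl (*-cong (≈-sym Ψ≈) ≈-refl)))

theorem4p3 : ∀ {c ℓ c′ ℓ′} (k : Field c ℓ) (A : CommAlgebra k c′ ℓ′) (Ξ : LinearMap A) →
    Invariant.Distinguishes A Ξ ⇔ Invariant.FinerThanα A Ξ
theorem4p3 k A Ξ = mk⇔ distinguishes⇒finer finer⇒distinguishes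
  where
  open Invariant A Ξ

  distinguishes⇒finer : Distinguishes → FinerThanα
  distinguishes⇒finer distinguishes T₁ T₂ _ _ α₁ α₂ m₁≢m₂ Ψ≈ =
    m₁≢m₂ (autOrder-≅ (proj₁ (distinguishes T₁ T₂) Ψ≈) α₁ α₂)

  finer⇒distinguishes : FinerThanα → Distinguishes
  finer⇒distinguishes finer T₁ T₂ =
    (λ Ψ≈ → decidable-stable (iso? T₁ T₂) (finer⇒Ψ-reflects-≅ A Ξ finer Ψ≈)) , Ψ-≅ A Ξ
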